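{- Let $i,n$ be integers with $1\le i\le n-2$, and let $\pi_1\in\mathfrak{S}_i(1243,2143,321)$ and $\pi_2\in\mathfrak{S}_{n-i}(1243,2143,321)$. Then $\pi_1*\pi_2\in\mathfrak{S}_n(1243,2143,321)$ if and only if all of the following hold: (i) at least one of $\pi_1,\pi_2$ begins with $1$; (ii) the entries $2,3,\dots,i$ appear in increasing order in $\pi_1$; (iii) the entries $\pi_2(2),\pi_2(3),\dots,\pi_2(n-i)$ are in increasing order.
   Context: $\mathfrak{S}_m(R)$ is the set of permutations of $\{1,\dots,m\}$ containing no subsequence with the same relative order as any pattern in $R$. For nonempty permutations $\pi_1,\pi_2$ (one-line notation), let $\tilde\pi_1$ be obtained by adding $|\pi_2|-1$ to every entry of $\pi_1$ and then replacing the entry $|\pi_2|$ (the smallest entry of the result) by the first entry of $\pi_2$; let $\tilde\pi_2$ be $\pi_2$ with its first entry removed; then $\pi_1*\pi_2$ is the concatenation $\tilde\pi_1,\,N,\,\tilde\pi_2$ with $N = |\pi_1|+|\pi_2|$. (Example: $3124*15342 = 716895342$.) -}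

module Defs where

open import Data.Nat using (ℕ; zero; suc; _+_; _∸_; _<_; _≤_; _≟_; _≤?_)
open import Data.Fin using (Fin; cast)
open import Data.List using (List; []; _∷_; _++_; length; lookup; map; upTo; filter; drop)
open import Data.List.Relation.Binary.Sublist.Propositional using (_⊆_)
open import Data.List.Relation.Binary.Permutation.Propositional using (_↭_)
open import Data.List.Relation.Unary.All using (All)
open import Data.List.Relation.Unary.Linked using (Linked)
open import Data.Product using (Σ; ∃; _×_)
open import Data.Bool using (if_then_else_)
open import Relation.Nullary using (¬_)
open import Relation.Nullary.Decidable using (⌊_⌋)
open import Relation.Binary.PropositionalEquality using (_≡_)
open import Function.Bundles using (_⇔_)

-- Permutations are lists of naturals in one-line notation.
-- w is a permutation of {1,…,m}
IsPerm : ℕ → List ℕ → Set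
IsPerm m w = w ↭ map suc (upTo m)

OrderIso : List ℕ → List ℕ → Set
OrderIso s p = Σ (length s ≡ length p) λ eq →
  ∀ (a b : Fin (length s)) →
    (lookup s a < lookup s b) ⇔ (lookup p (cast eq a) < lookup p (cast eq b))

Contains : List ℕ → List ℕ → Set
Contains w p = ∃ λ s → (s ⊆ w) × OrderIso s p

Avoids : List ℕ → List ℕ → Set
Avoids w p = ¬ Contains w p

InS : ℕ → List (List ℕ) → List ℕ → Set
InS m R w = IsPerm m w × All (Avoids w) R

-- The product π₁ * π₂ (π₂ is assumed nonempty; the [] case is a dummy).
_⋆_ : List ℕ → List ℕ → List ℕ
π₁ ⋆ [] = π₁
π₁ ⋆ (b ∷ rest) =
  map (λ x → if ⌊ x ≟ 1 ⌋ then b else x + length rest) π₁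
  ++ (length π₁ + suc (length rest)) ∷ rest

Increasing : List ℕ → Set
Increasing = Linked _<_

R₀ : List (List ℕ)
R₀ = (1 ∷ 2 ∷ 4 ∷ 3 ∷ []) ∷ (2 ∷ 1 ∷ 4 ∷ 3 ∷ []) ∷ (3 ∷ 2 ∷ 1 ∷ []) ∷ []

entries≥2 : List ℕ → List ℕ
entries≥2 = filter (2 ≤?_)

StartsWith1 : List ℕ → Set
StartsWith1 w = ∃ λ t → w ≡ 1 ∷ t

-- Write π₁ ⋆ π₂ = π̃₁ N π̃₂ and m = |π₂| - 1.  In π̃₁ the entry 1 of π₁ has become
-- b = π₂(1) ≤ m + 1 and every other entry x has become x + m ≥ m + 2; N is the
-- maximum, and π̃₂ consists of entries ≤ m + 1.
--
-- Under the three conditions π̃₂ is increasing, the large entries of π̃₁ are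
-- increasing, and the single small entry b of π̃₁ is 1 as soon as it is preceded
-- in π̃₁.  Hence every descent of π₁ ⋆ π₂ ends in a small entry, and locating an
-- occurrence of 321, 1243 or 2143 relative to the blocks π̃₁ and N π̃₂ rules it out.
--
-- Conversely each failing condition produces a 321: N u v for a descent u v of π̃₂;
-- (x + m) (y + m) π₂(2) for a descent x y among the entries ≥ 2 of π₁; and
-- (π₁(1) + m) b 1 when neither permutation starts with 1.
module Submission where

open import Defs
open import Data.Bool using (if_then_else_)
open import Data.Empty using (⊥-elim)
open import Data.Fin using (Fin; cast)
open import Data.Fin.Patterns using (0F; 1F; 2F; 3F)
open import Data.List using (List; []; _∷_; _++_; [_]; length; lookup; map; upTo; applyUpTo; filter; drop)
open import Data.List.Properties using (∷-injectiveˡ; map-∘; ++-assoc; map-upTo; applyUpTo-∷ʳ; filter-all; length-map; length-upTo)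
open import Data.List.Membership.Propositional using (_∈_)
open import Data.List.Membership.Propositional.Properties using (∈-map⁻; ∈-upTo⁻)
open import Data.List.Relation.Binary.Permutation.Propositional using (↭-sym; prep; ↭⇒↭ₛ; module PermutationReasoning)
import Data.List.Relation.Binary.Permutation.Propositional.Properties as ↭
import Data.List.Relation.Binary.Permutation.Setoid.Properties as ↭ₛ
open import Data.List.Relation.Binary.Sublist.Propositional using (_⊆_; []; _∷_; _∷ʳ_; ⊆-refl; ⊆-trans; to∈; from∈; minimum)
open import Data.List.Relation.Binary.Sublist.Propositional.Properties using (map⁺; ∷⁻; ∷ˡ⁻; ++⁺; ++⁺ˡ; ++⁺ʳ; filter-⊆; filter⁺; All-resp-⊆)
open import Data.List.Relation.Unary.All as All using (All; []; _∷_)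
open import Data.List.Relation.Unary.All.Properties using (all-filter)
open import Data.List.Relation.Unary.AllPairs as AllPairs using (AllPairs; []; _∷_)
open import Data.List.Relation.Unary.Any as Any using (here; there)
open import Data.List.Relation.Unary.Linked.Properties using (AllPairs⇒Linked; Linked⇒AllPairs)
open import Data.List.Relation.Unary.Unique.Propositional using (Unique)
import Data.List.Relation.Unary.Unique.Propositional.Properties as Unique
open import Data.Nat using (ℕ; zero; suc; _+_; _∸_; _<_; _≤_; z≤n; s≤s; _≟_; _≤?_)
open import Data.Nat.Properties
open import Data.Product using (∃₂; _×_; _,_; proj₁; proj₂)
open import Data.Sum using (_⊎_; inj₁; inj₂)
open import Function using (_∘_)
open import Function.Bundles using (_⇔_; mk⇔; Equivalence)
open import Level using (0ℓ)
open import Relation.Binary.Core using (Rel)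
open import Relation.Binary.PropositionalEquality using (_≡_; _≢_; ≢-sym; refl; sym; trans; cong; cong₂; subst; setoid; module ≡-Reasoning)
open import Relation.Nullary using (¬_; Dec; yes; no; contradiction)
open import Relation.Nullary.Decidable using (⌊_⌋)
open import Relation.Unary using (Pred; Decidable)

private
  variable
    A B : Set
    x u v : A
    xs s : List A

⊆-prefix : ∀ (ys : List A) → xs ++ ys ⊆ s → xs ⊆ s
⊆-prefix ys = ⊆-trans (++⁺ʳ ys ⊆-refl)

⊆-++-split : ∀ (xs : List A) {ys s} → s ⊆ xs ++ ys →
             ∃₂ λ s₁ s₂ → s ≡ s₁ ++ s₂ × s₁ ⊆ xs × s₂ ⊆ ys
⊆-++-split []       p          = [] , _ , refl , [] , p
⊆-++-split (x ∷ xs) (_ ∷ʳ p)   with s₁ , s₂ , eq , q , r ← ⊆-++-split xs p = s₁ , s₂ , eq , x ∷ʳ q , r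
⊆-++-split (x ∷ xs) (refl ∷ p) with s₁ , s₂ , refl , q , r ← ⊆-++-split xs p = x ∷ s₁ , s₂ , refl , refl ∷ q , r

⊆-++-split₄ : ∀ (xs : List A) {y ys a b c d} → (a ∷ b ∷ c ∷ d ∷ []) ⊆ xs ++ y ∷ ys →
              (a ∷ b ∷ []) ⊆ xs ⊎ (c ∷ d ∷ []) ⊆ ys
⊆-++-split₄ xs sub with ⊆-++-split xs sub
... | [] , _ , refl , _ , q                 = inj₂ (∷ˡ⁻ (∷⁻ q))
... | _ ∷ [] , _ , refl , _ , q             = inj₂ (∷⁻ q)
... | _ ∷ _ ∷ [] , _ , refl , p , _         = inj₁ p
... | _ ∷ _ ∷ _ ∷ [] , _ , refl , p , _     = inj₁ (⊆-prefix [ _ ] p)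
... | _ ∷ _ ∷ _ ∷ _ ∷ [] , _ , refl , p , _ = inj₁ (⊆-prefix (_ ∷ _ ∷ []) p)

pair-⊆-map⁻ : ∀ (f : A → B) xs {u v} → (u ∷ v ∷ []) ⊆ map f xs →
              ∃₂ λ u′ v′ → (u′ ∷ v′ ∷ []) ⊆ xs × f u′ ≡ u × f v′ ≡ v
pair-⊆-map⁻ f (x ∷ xs) (_ ∷ʳ p)   with u′ , v′ , q , eqs ← pair-⊆-map⁻ f xs p = u′ , v′ , x ∷ʳ q , eqs
pair-⊆-map⁻ f (x ∷ xs) (refl ∷ p) with v′ , v′∈xs , refl ← ∈-map⁻ f (to∈ p) =
  x , v′ , refl ∷ from∈ v′∈xs , refl , refl

AllPairs-⊆ : ∀ {R : Rel A 0ℓ} → AllPairs R xs → (u ∷ v ∷ []) ⊆ xs → R u v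
AllPairs-⊆ (_ ∷ rs) (_ ∷ʳ p)   = AllPairs-⊆ rs p
AllPairs-⊆ (r ∷ _)  (refl ∷ p) = All.lookup r (to∈ p)

⊆-AllPairs : ∀ {R : Rel A 0ℓ} → (∀ {u v} → (u ∷ v ∷ []) ⊆ xs → R u v) → AllPairs R xs
⊆-AllPairs {xs = []}     h = []
⊆-AllPairs {xs = x ∷ xs} h = All.tabulate (λ v∈xs → h (refl ∷ from∈ v∈xs)) ∷ ⊆-AllPairs (h ∘ (x ∷ʳ_))

module _ {P : Pred A 0ℓ} (P? : Decidable P) where

  ⊆-filter⁻ : ∀ xs → s ⊆ filter P? xs → s ⊆ xs × All P s
  ⊆-filter⁻ xs p = ⊆-trans p (filter-⊆ P? xs) , All-resp-⊆ p (all-filter P? xs)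

  ⊆-filter⁺ : s ⊆ xs → All P s → s ⊆ filter P? xs
  ⊆-filter⁺ {xs = xs} p ps =
    subst (_⊆ filter P? xs) (filter-all P? ps) (filter⁺ P? P? (λ { refl Px → Px }) p)

Increasing-⊆ : Increasing xs → (u ∷ v ∷ []) ⊆ xs → u < v
Increasing-⊆ = AllPairs-⊆ ∘ Linked⇒AllPairs <-trans

Unique∧ascending⇒Increasing : Unique xs → (∀ {u v} → (u ∷ v ∷ []) ⊆ xs → ¬ v < u) → Increasing xs
Unique∧ascending⇒Increasing distinct ascending =
  AllPairs⇒Linked (⊆-AllPairs λ p → ≤∧≢⇒< (≮⇒≥ (ascending p)) (AllPairs-⊆ distinct p))

module _ {k : ℕ} {π : List ℕ} (π-perm : IsPerm k π) where

  IsPerm⇒length : length π ≡ k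
  IsPerm⇒length = trans (↭.↭-length π-perm) (trans (length-map suc (upTo k)) (length-upTo k))

  IsPerm⇒Unique : Unique π
  IsPerm⇒Unique =
    ↭ₛ.Unique-resp-↭ (setoid ℕ) (↭⇒↭ₛ (↭-sym π-perm)) (Unique.map⁺ suc-injective (Unique.upTo⁺ k))

  IsPerm⇒bounds : x ∈ π → 1 ≤ x × x ≤ k
  IsPerm⇒bounds x∈π with j , j∈upTo , refl ← ∈-map⁻ suc (↭.∈-resp-↭ π-perm x∈π) =
    s≤s z≤n , ∈-upTo⁻ j∈upTo

IsPerm⇒1∈ : ∀ {k π} → IsPerm (suc k) π → 1 ∈ π
IsPerm⇒1∈ π-perm = ↭.∈-resp-↭ (↭-sym π-perm) (here refl)

applyUpTo-cong : ∀ {f g : ℕ → A} → (∀ i → f i ≡ g i) → ∀ n → applyUpTo f n ≡ applyUpTo g n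
applyUpTo-cong f≗g zero    = refl
applyUpTo-cong f≗g (suc n) = cong₂ _∷_ (f≗g 0) (applyUpTo-cong (f≗g ∘ suc) n)

applyUpTo-+ : ∀ (f : ℕ → A) j k → applyUpTo f (j + k) ≡ applyUpTo f j ++ applyUpTo (f ∘ (j +_)) k
applyUpTo-+ f zero    k = refl
applyUpTo-+ f (suc j) k = cong (f 0 ∷_) (applyUpTo-+ (f ∘ suc) j k)

upTo-blocks : ∀ m l → map suc (upTo (suc m)) ++ applyUpTo (λ x → suc (suc x) + m) l ++ [ suc l + suc m ]
                      ≡ map suc (upTo (suc l + suc m))
upTo-blocks m l = begin
  map suc (upTo (suc m)) ++ applyUpTo (λ x → suc (suc x) + m) l ++ [ suc l + suc m ]
    ≡⟨ cong₂ _++_ (map-upTo suc (suc m))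
                  (cong₂ (λ xs y → xs ++ [ y ]) (applyUpTo-cong (λ x → cong (suc ∘ suc) (+-comm x m)) l)
                                                (cong suc (+-comm l (suc m)))) ⟩
  applyUpTo suc (suc m) ++ applyUpTo g l ++ [ g l ]
    ≡⟨ cong (applyUpTo suc (suc m) ++_) (applyUpTo-∷ʳ g l) ⟩
  applyUpTo suc (suc m) ++ applyUpTo g (suc l)
    ≡⟨ applyUpTo-+ suc (suc m) (suc l) ⟨
  applyUpTo suc (suc m + suc l)
    ≡⟨ cong (applyUpTo suc) (+-comm (suc m) (suc l)) ⟩
  applyUpTo suc (suc l + suc m)
    ≡⟨ map-upTo suc (suc l + suc m) ⟨
  map suc (upTo (suc l + suc m)) ∎
  where
  open ≡-Reasoning
  g : ℕ → ℕ
  g = suc ∘ (suc m +_)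

data Has321 (w : List ℕ) : Set where
  has321 : ∀ {x y z} → (x ∷ y ∷ z ∷ []) ⊆ w → y < x → z < y → Has321 w

-- A common weakening of an occurrence of 1243 and of 2143, which differ only in the
-- order of their first two entries.
data Has··43 (w : List ℕ) : Set where
  has··43 : ∀ {a b c d} → (a ∷ b ∷ c ∷ d ∷ []) ⊆ w → a < d → b < d → d < c → Has··43 w

1243⇒Has··43 : ∀ {w} → Contains w (1 ∷ 2 ∷ 4 ∷ 3 ∷ []) → Has··43 w
1243⇒Has··43 ([]                    , _ , () , _)
1243⇒Has··43 (_ ∷ []                , _ , () , _)
1243⇒Has··43 (_ ∷ _ ∷ []            , _ , () , _)
1243⇒Has··43 (_ ∷ _ ∷ _ ∷ []        , _ , () , _)
1243⇒Has··43 (_ ∷ _ ∷ _ ∷ _ ∷ _ ∷ _ , _ , () , _)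
1243⇒Has··43 (_ ∷ _ ∷ _ ∷ _ ∷ []    , sub , refl , iso) =
  has··43 sub (from (iso 0F 3F) (s≤s (s≤s z≤n))) (from (iso 1F 3F) (s≤s (s≤s (s≤s z≤n))))
              (from (iso 3F 2F) ≤-refl)
  where open Equivalence

2143⇒Has··43 : ∀ {w} → Contains w (2 ∷ 1 ∷ 4 ∷ 3 ∷ []) → Has··43 w
2143⇒Has··43 ([]                    , _ , () , _)
2143⇒Has··43 (_ ∷ []                , _ , () , _)
2143⇒Has··43 (_ ∷ _ ∷ []            , _ , () , _)
2143⇒Has··43 (_ ∷ _ ∷ _ ∷ []        , _ , () , _)
2143⇒Has··43 (_ ∷ _ ∷ _ ∷ _ ∷ _ ∷ _ , _ , () , _)
2143⇒Has··43 (_ ∷ _ ∷ _ ∷ _ ∷ []    , sub , refl , iso) =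
  has··43 sub (from (iso 0F 3F) (s≤s (s≤s (s≤s z≤n)))) (from (iso 1F 3F) (s≤s (s≤s z≤n)))
              (from (iso 3F 2F) ≤-refl)
  where open Equivalence

321⇒Has321 : ∀ {w} → Contains w (3 ∷ 2 ∷ 1 ∷ []) → Has321 w
321⇒Has321 ([]                , _ , () , _)
321⇒Has321 (_ ∷ []            , _ , () , _)
321⇒Has321 (_ ∷ _ ∷ []        , _ , () , _)
321⇒Has321 (_ ∷ _ ∷ _ ∷ _ ∷ _ , _ , () , _)
321⇒Has321 (_ ∷ _ ∷ _ ∷ []    , sub , refl , iso) =
  has321 sub (from (iso 1F 0F) ≤-refl) (from (iso 2F 1F) ≤-refl)
  where open Equivalence

Has321⇒321 : ∀ {w} → Has321 w → Contains w (3 ∷ 2 ∷ 1 ∷ [])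
Has321⇒321 (has321 {x} {y} {z} sub y<x z<y) = xyz , sub , refl , iso
  where
  xyz 321′ : List ℕ
  xyz  = x ∷ y ∷ z ∷ []
  321′ = 3 ∷ 2 ∷ 1 ∷ []
  both : ∀ {P Q : Set} → P → Q → P ⇔ Q
  both p q = mk⇔ (λ _ → q) (λ _ → p)
  neither : ∀ {P Q : Set} → ¬ P → ¬ Q → P ⇔ Q
  neither ¬p ¬q = mk⇔ (⊥-elim ∘ ¬p) (⊥-elim ∘ ¬q)
  iso : ∀ (i j : Fin 3) →
        lookup xyz i < lookup xyz j ⇔ lookup 321′ (cast refl i) < lookup 321′ (cast refl j)
  iso 0F 0F = neither (<-irrefl refl) (<-irrefl refl)
  iso 0F 1F = neither (<-asym y<x) (<-asym ≤-refl)
  iso 0F 2F = neither (<-asym (<-trans z<y y<x)) (<-asym (s≤s (s≤s z≤n)))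
  iso 1F 0F = both y<x ≤-refl
  iso 1F 1F = neither (<-irrefl refl) (<-irrefl refl)
  iso 1F 2F = neither (<-asym z<y) (<-asym ≤-refl)
  iso 2F 0F = both (<-trans z<y y<x) (s≤s (s≤s z≤n))
  iso 2F 1F = both z<y ≤-refl
  iso 2F 2F = neither (<-irrefl refl) (<-irrefl refl)

record Shape (L : List ℕ) (N : ℕ) (R : List ℕ) (M : ℕ) : Set where
  field
    L-below-N          : All (_< N) L
    N∷R-positive       : All (1 ≤_) (N ∷ R)
    R-small            : All (_< M) R
    R-increasing       : Increasing R
    L-large-increasing : (u ∷ v ∷ []) ⊆ L → M ≤ u → M ≤ v → u < v
    L-preceded-small   : (u ∷ v ∷ []) ⊆ L → v < M → M ≤ u × v ≤ 1

module _ {L N R M} (shape : Shape L N R M) where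
  open Shape shape

  descent-in-L-small : (u ∷ v ∷ []) ⊆ L → v < u → v < M
  descent-in-L-small p v<u =
    ≰⇒> λ M≤v → <-asym v<u (L-large-increasing p (≤-trans M≤v (<⇒≤ v<u)) M≤v)

  descent-small : (u ∷ v ∷ []) ⊆ L ++ N ∷ R → v < u → v < M
  descent-small p v<u with ⊆-++-split L p
  ... | [] , _ , refl , _ , q               = All.lookup R-small (to∈ (∷⁻ q))
  ... | _ ∷ [] , _ , refl , _ , (_ ∷ʳ q)    = All.lookup R-small (to∈ q)
  ... | _ ∷ [] , _ , refl , p′ , (refl ∷ _) = contradiction (All.lookup L-below-N (to∈ p′)) (<-asym v<u)
  ... | _ ∷ _ ∷ [] , [] , refl , p′ , _     = descent-in-L-small p′ v<u

  avoids-321 : ¬ Has321 (L ++ N ∷ R)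
  avoids-321 (has321 sub y<x z<y) with ⊆-++-split L sub
  ... | [] , _ , refl , _ , q              = <-asym z<y (Increasing-⊆ R-increasing (∷⁻ q))
  ... | _ ∷ [] , _ , refl , _ , (_ ∷ʳ q)   = <-asym z<y (Increasing-⊆ R-increasing q)
  ... | _ ∷ [] , _ , refl , p , (refl ∷ _) = <-asym y<x (All.lookup L-below-N (to∈ p))
  ... | _ ∷ _ ∷ [] , _ ∷ [] , refl , p , q =
    <⇒≱ (≤-trans z<y (proj₂ (L-preceded-small p (descent-in-L-small p y<x))))
        (All.lookup N∷R-positive (to∈ q))
  ... | _ ∷ _ ∷ _ ∷ [] , [] , refl , p , _ =
    <⇒≱ (descent-in-L-small (⊆-prefix [ _ ] p) y<x)
        (proj₁ (L-preceded-small (∷ˡ⁻ p) (descent-in-L-small (∷ˡ⁻ p) z<y)))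

  avoids-··43 : ¬ Has··43 (L ++ N ∷ R)
  avoids-··43 (has··43 sub a<d b<d d<c) with ⊆-++-split₄ L sub | descent-small (∷ˡ⁻ (∷ˡ⁻ sub)) d<c
  ... | inj₁ p | d<M = <⇒≱ (<-trans a<d d<M) (proj₁ (L-preceded-small p (<-trans b<d d<M)))
  ... | inj₂ q | _   = <-asym d<c (Increasing-⊆ R-increasing q)

  avoids-R₀ : All (Avoids (L ++ N ∷ R)) R₀
  avoids-R₀ = avoids-··43 ∘ 1243⇒Has··43 ∷ avoids-··43 ∘ 2143⇒Has··43 ∷ avoids-321 ∘ 321⇒Has321 ∷ []

Conditions : List ℕ → List ℕ → Set
Conditions π₁ π₂ = (StartsWith1 π₁ ⊎ StartsWith1 π₂) × Increasing (entries≥2 π₁) × Increasing (drop 1 π₂)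

1-unpreceded : ∀ {π u} → StartsWith1 π → Unique π → ¬ (u ∷ 1 ∷ []) ⊆ π
1-unpreceded (_ , refl) (1∉t ∷ _) p = All.lookup 1∉t (to∈ (∷⁻ p)) refl

module Product (a : ℕ) (t : List ℕ) (b r : ℕ) (rs : List ℕ)
               (π₁-perm : IsPerm (length (a ∷ t)) (a ∷ t))
               (π₂-perm : IsPerm (length (b ∷ r ∷ rs)) (b ∷ r ∷ rs)) where

  π₁ π₂ π̃₂ : List ℕ
  π₁  = a ∷ t
  π₂  = b ∷ π̃₂
  π̃₂ = r ∷ rs

  m M N : ℕ
  m = length π̃₂
  M = 2 + m
  N = length π₁ + suc m

  f : ℕ → ℕ
  f x = if ⌊ x ≟ 1 ⌋ then b else x + m

  π̃₁ : List ℕ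
  π̃₁ = map f π₁

  lifted : List ℕ
  lifted = applyUpTo (λ x → suc (suc x) + m) (length t)

  f-image : map f (map suc (upTo (length π₁))) ≡ b ∷ lifted
  f-image = trans (sym (map-∘ (upTo (length π₁)))) (map-upTo (f ∘ suc) (length π₁))

  ⋆-perm : IsPerm N (π₁ ⋆ π₂)
  ⋆-perm = begin
    π̃₁ ++ N ∷ π̃₂                                 ↭⟨ ↭.++⁺ʳ (N ∷ π̃₂) (↭.map⁺ f π₁-perm) ⟩
    map f (map suc (upTo (length π₁))) ++ N ∷ π̃₂ ≡⟨ cong (_++ N ∷ π̃₂) f-image ⟩
    b ∷ lifted ++ N ∷ π̃₂                         ≡⟨ cong (b ∷_) (++-assoc lifted [ N ] π̃₂) ⟨
    b ∷ (lifted ++ [ N ]) ++ π̃₂                  ↭⟨ prep b (↭.++-comm (lifted ++ [ N ]) π̃₂) ⟩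
    π₂ ++ lifted ++ [ N ]                         ↭⟨ ↭.++⁺ʳ (lifted ++ [ N ]) π₂-perm ⟩
    map suc (upTo (suc m)) ++ lifted ++ [ N ]     ≡⟨ upTo-blocks m (length t) ⟩
    map suc (upTo N)                              ∎
    where open PermutationReasoning

  π₁-unique : Unique π₁
  π₁-unique = IsPerm⇒Unique π₁-perm

  π₁-positive : x ∈ π₁ → 1 ≤ x
  π₁-positive = proj₁ ∘ IsPerm⇒bounds π₁-perm

  π₂-positive : x ∈ π₂ → 1 ≤ x
  π₂-positive = proj₁ ∘ IsPerm⇒bounds π₂-perm

  π₂-small : x ∈ π₂ → x < M
  π₂-small = s≤s ∘ proj₂ ∘ IsPerm⇒bounds π₂-perm

  f-large : 2 ≤ x → M ≤ f x
  f-large (s≤s (s≤s {n = x} z≤n)) = s≤s (s≤s (m≤n+m m x))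

  f-large⁻¹ : 1 ≤ x → M ≤ f x → 2 ≤ x
  f-large⁻¹ {suc zero}    _ M≤b = contradiction M≤b (<⇒≱ (π₂-small (here refl)))
  f-large⁻¹ {suc (suc x)} _ _   = s≤s (s≤s z≤n)

  f-small⁻¹ : 1 ≤ x → f x < M → x ≡ 1
  f-small⁻¹ {suc zero}    _ _    = refl
  f-small⁻¹ {suc (suc x)} _ fx<M = contradiction (f-large (s≤s (s≤s z≤n))) (<⇒≱ fx<M)

  f-mono : 2 ≤ u → u < v → f u < f v
  f-mono (s≤s (s≤s z≤n)) u<v@(s≤s (s≤s _)) = +-monoˡ-< m u<v

  π̃₁-below-N : All (_< N) π̃₁
  π̃₁-below-N = All.tabulate λ x∈π̃₁ → below-N (++⁺ (from∈ x∈π̃₁) (refl ∷ minimum π̃₂))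
    where
    below-N : (x ∷ N ∷ []) ⊆ π₁ ⋆ π₂ → x < N
    below-N p =
      ≤∧≢⇒< (proj₂ (IsPerm⇒bounds ⋆-perm (to∈ p))) (AllPairs-⊆ (IsPerm⇒Unique ⋆-perm) p)

  π̃₂-below-N : x ∈ π̃₂ → x < N
  π̃₂-below-N x∈π̃₂ = <-≤-trans (π₂-small (there x∈π̃₂)) (s≤s (m≤n+m (suc m) (length t)))

  b≡1-if-1-preceded : StartsWith1 π₁ ⊎ StartsWith1 π₂ → (u ∷ 1 ∷ []) ⊆ π₁ → b ≡ 1
  b≡1-if-1-preceded (inj₁ π₁-starts-with-1) p =
    contradiction p (1-unpreceded π₁-starts-with-1 π₁-unique)
  b≡1-if-1-preceded (inj₂ (_ , π₂≡1∷π̃₂))    _ = ∷-injectiveˡ π₂≡1∷π̃₂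

  shape : Conditions π₁ π₂ → Shape π̃₁ N π̃₂ M
  shape (starts-with-1 , ≥2-increasing , π̃₂-increasing) = record
    { L-below-N          = π̃₁-below-N
    ; N∷R-positive       = s≤s z≤n ∷ All.tabulate (π₂-positive ∘ there)
    ; R-small            = All.tabulate (π₂-small ∘ there)
    ; R-increasing       = π̃₂-increasing
    ; L-large-increasing = large-increasing
    ; L-preceded-small   = preceded-small
    }
    where
    large-increasing : (u ∷ v ∷ []) ⊆ π̃₁ → M ≤ u → M ≤ v → u < v
    large-increasing p M≤u M≤v with u′ , v′ , q , refl , refl ← pair-⊆-map⁻ f π₁ p =
      f-mono 2≤u′ (Increasing-⊆ ≥2-increasing (⊆-filter⁺ (2 ≤?_) q (2≤u′ ∷ 2≤v′ ∷ [])))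
      where
      2≤u′ : 2 ≤ u′
      2≤u′ = f-large⁻¹ (π₁-positive (to∈ q)) M≤u
      2≤v′ : 2 ≤ v′
      2≤v′ = f-large⁻¹ (π₁-positive (to∈ (∷ˡ⁻ q))) M≤v

    preceded-small : (u ∷ v ∷ []) ⊆ π̃₁ → v < M → M ≤ u × v ≤ 1
    preceded-small p v<M with u′ , v′ , q , refl , refl ← pair-⊆-map⁻ f π₁ p
                         with refl ← f-small⁻¹ (π₁-positive (to∈ (∷ˡ⁻ q))) v<M =
      f-large (≤∧≢⇒< (π₁-positive (to∈ q)) (≢-sym (AllPairs-⊆ π₁-unique q))) ,
      ≤-reflexive (b≡1-if-1-preceded starts-with-1 q)

  neither-starts-with-1⇒321 : a ≢ 1 → b ≢ 1 → Has321 (π₁ ⋆ π₂)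
  neither-starts-with-1⇒321 a≢1 b≢1 =
    has321 (++⁺ (map⁺ f a,1⊆π₁) (N ∷ʳ from∈ 1∈π̃₂))
           (<-≤-trans (π₂-small (here refl))
                      (f-large {a} (≤∧≢⇒< (π₁-positive (here refl)) (a≢1 ∘ sym))))
           (≤∧≢⇒< (π₂-positive (here refl)) (b≢1 ∘ sym))
    where
    a,1⊆π₁ : (a ∷ 1 ∷ []) ⊆ π₁
    a,1⊆π₁ = refl ∷ from∈ (Any.tail (a≢1 ∘ sym) (IsPerm⇒1∈ π₁-perm))
    1∈π̃₂ : 1 ∈ π̃₂
    1∈π̃₂ = Any.tail (b≢1 ∘ sym) (IsPerm⇒1∈ π₂-perm)

  module _ (no-321 : ¬ Has321 (π₁ ⋆ π₂)) where

    π̃₂-increasing : Increasing π̃₂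
    π̃₂-increasing =
      Unique∧ascending⇒Increasing (AllPairs.tail (IsPerm⇒Unique π₂-perm)) λ p v<u →
        no-321 (has321 (++⁺ˡ π̃₁ (refl ∷ p)) (π̃₂-below-N (to∈ p)) v<u)

    ≥2-increasing : Increasing (entries≥2 π₁)
    ≥2-increasing = Unique∧ascending⇒Increasing (Unique.filter⁺ (2 ≤?_) π₁-unique) ascending
      where
      ascending : (u ∷ v ∷ []) ⊆ entries≥2 π₁ → ¬ v < u
      ascending p v<u with q , _ ∷ 2≤v ∷ [] ← ⊆-filter⁻ (2 ≤?_) π₁ p =
        no-321 (has321 (++⁺ (map⁺ f q) (N ∷ʳ refl ∷ minimum rs)) (f-mono 2≤v v<u)
                       (<-≤-trans (π₂-small (there (here refl))) (f-large 2≤v)))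

    starts-with-1 : StartsWith1 π₁ ⊎ StartsWith1 π₂
    starts-with-1 = decide (a ≟ 1) (b ≟ 1)
      where
      decide : Dec (a ≡ 1) → Dec (b ≡ 1) → StartsWith1 π₁ ⊎ StartsWith1 π₂
      decide (yes a≡1) _         = inj₁ (t , cong (_∷ t) a≡1)
      decide (no _)    (yes b≡1) = inj₂ (π̃₂ , cong (_∷ π̃₂) b≡1)
      decide (no a≢1)  (no b≢1)  = contradiction (neither-starts-with-1⇒321 a≢1 b≢1) no-321

    conditions : Conditions π₁ π₂
    conditions = starts-with-1 , ≥2-increasing , π̃₂-increasing

  InS⇔Conditions : InS N R₀ (π₁ ⋆ π₂) ⇔ Conditions π₁ π₂
  InS⇔Conditions = mk⇔ InS⇒Conditions (λ c → ⋆-perm , avoids-R₀ (shape c))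
    where
    InS⇒Conditions : InS N R₀ (π₁ ⋆ π₂) → Conditions π₁ π₂
    InS⇒Conditions (_ , _ ∷ _ ∷ avoids-321 ∷ []) = conditions (avoids-321 ∘ Has321⇒321)

⋆-InS⇔Conditions : ∀ {k₁ k₂} π₁ π₂ → 1 ≤ k₁ → 2 ≤ k₂ → IsPerm k₁ π₁ → IsPerm k₂ π₂ →
                   InS (k₁ + k₂) R₀ (π₁ ⋆ π₂) ⇔ Conditions π₁ π₂
⋆-InS⇔Conditions π₁ π₂ _ _ π₁-perm π₂-perm with IsPerm⇒length π₁-perm | IsPerm⇒length π₂-perm
⋆-InS⇔Conditions (a ∷ t) (b ∷ r ∷ rs) _ _ π₁-perm π₂-perm | refl | refl =
  Product.InS⇔Conditions a t b r rs π₁-perm π₂-perm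
⋆-InS⇔Conditions (_ ∷ _) (_ ∷ []) _ (s≤s ()) _ _ | refl | refl

lemma7p3 : (i n : ℕ) → 1 ≤ i → i + 2 ≤ n → (π₁ π₂ : List ℕ) →
    InS i R₀ π₁ → InS (n ∸ i) R₀ π₂ →
    InS n R₀ (π₁ ⋆ π₂) ⇔
      ((StartsWith1 π₁ ⊎ StartsWith1 π₂) × Increasing (entries≥2 π₁) × Increasing (drop 1 π₂))
lemma7p3 i n 1≤i i+2≤n π₁ π₂ (π₁-perm , _) (π₂-perm , _) =
  subst (λ k → InS k R₀ (π₁ ⋆ π₂) ⇔ Conditions π₁ π₂) (m+[n∸m]≡n (m+n≤o⇒m≤o i i+2≤n))
        (⋆-InS⇔Conditions π₁ π₂ 1≤i (m+n≤o⇒m≤o∸n 2 (subst (_≤ n) (+-comm i 2) i+2≤n)) π₁-perm π₂-perm)
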